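{- For $l\ge5$, \[f^+_{D_l}(t)=\frac{1}{2(l-1)}(lt-2)f_{B_l}(t)+\frac{1}{2(l-1)}\{2(2l-1)t^2-5lt+2l\}f_{B_{l-1}}(t).\]
   Context: For $n\ge1$, $f_{B_n}(t)=\sum_{j=0}^n(-1)^j\binom nj\binom{n+j}{j}t^j$ (the $f$-polynomial of the cluster complex of type $B_n$). Let $f^+_{D_l}(t)=\sum_i c_i^+(-t)^i$, where $c_i^+$ is the number of $i$-vertex faces of the positive part (induced subcomplex on the positive roots) of the Fomin–Zelevinsky cluster complex of type $D_l$; equivalently (known) $f^+_{D_l}(t)=\frac{1}{(l-2)!}\frac{d^{l-3}}{dt^{l-3}}\big[t^{l-3}(1-t)^{l-2}\{(l-2)-(3l-4)t+(3l-4)t^2\}\big]$. -}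

module Defs where

open import Data.Nat as ℕ using (ℕ; zero; suc; _∸_; _<ᵇ_)
open import Data.Nat.Properties using (_!≢0)
open import Data.Nat.Combinatorics using (_C_)
open import Data.Nat.Base using (_!)
open import Data.Bool using (if_then_else_)
open import Data.Integer as ℤ using (ℤ; +_)
open import Data.Rational using (ℚ; 0ℚ; 1ℚ; _+_; _*_; -_; _-_; _/_)

-- A polynomial in one variable t over ℚ, represented by its coefficient
-- sequence: p i is the coefficient of t^i.  All polynomials built below
-- have finite support.
Poly : Set
Poly = ℕ → ℚ

ℕ→ℚ : ℕ → ℚ
ℕ→ℚ n = (+ n) / 1

sgn : ℕ → ℚ
sgn zero = 1ℚ
sgn (suc j) = - sgn j

sumTo : ℕ → (ℕ → ℚ) → ℚ
sumTo zero g = g zero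
sumTo (suc n) g = sumTo n g + g (suc n)

_⊕_ : Poly → Poly → Poly
(p ⊕ q) k = p k + q k

_⊛_ : Poly → Poly → Poly
(p ⊛ q) k = sumTo k (λ i → p i * q (k ∸ i))

_·_ : ℚ → Poly → Poly
(c · p) k = c * p k

mono : ℚ → ℕ → Poly
mono c m k = if k ℕ.≡ᵇ m then c else 0ℚ

deriv : Poly → Poly
deriv p k = ℕ→ℚ (suc k) * p (suc k)

derivIter : ℕ → Poly → Poly
derivIter zero p = p
derivIter (suc m) p = deriv (derivIter m p)

oneMinusTPow : ℕ → Poly
oneMinusTPow n k = sgn k * ℕ→ℚ (n C k)

-- f_{B_n}(t) = Σ_{j=0}^n (-1)^j C(n,j) C(n+j,j) t^j
-- (n C j = 0 for j > n, so the coefficients vanish beyond degree n)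
fB : ℕ → Poly
fB n j = sgn j * ℕ→ℚ ((n C j) ℕ.* ((n ℕ.+ j) C j))

fDplus : ℕ → Poly
fDplus l =
  ((+ 1) / ((l ∸ 2) !)) {{(l ∸ 2) !≢0}}
    · derivIter (l ∸ 3)
        (mono 1ℚ (l ∸ 3) ⊛ (oneMinusTPow (l ∸ 2) ⊛
          (mono (ℕ→ℚ (l ∸ 2)) 0 ⊕ (mono (- ℕ→ℚ (3 ℕ.* l ∸ 4)) 1
                                   ⊕ mono (ℕ→ℚ (3 ℕ.* l ∸ 4)) 2))))

nz8p10 : ∀ {l} → 5 ℕ.≤ l → ℕ.NonZero (2 ℕ.* (l ∸ 1))
nz8p10 (ℕ.s≤s (ℕ.s≤s _)) = _

rhs8p10 : (l : ℕ) → 5 ℕ.≤ l → Poly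
rhs8p10 l h = let instance _ = nz8p10 h in
  (((+ 1) / (2 ℕ.* (l ∸ 1))) ·
     ((mono (ℕ→ℚ l) 1 ⊕ mono (- ℕ→ℚ 2) 0) ⊛ fB l))
  ⊕ (((+ 1) / (2 ℕ.* (l ∸ 1))) ·
     ((mono (ℕ→ℚ (2 ℕ.* (2 ℕ.* l ∸ 1))) 2
        ⊕ (mono (- ℕ→ℚ (5 ℕ.* l)) 1 ⊕ mono (ℕ→ℚ (2 ℕ.* l)) 0))
      ⊛ fB (l ∸ 1)))

{-# OPTIONS --safe #-}
-- The (l-3)-rd derivative of t^(l-3)·p(t) has i-th coefficient
-- (i+l-3)!/i! · p_i, and the coefficients of (1-t)^(l-2) and of f_{B_m} are ratios of
-- factorials.  With l = n+5, every term contributing to the coefficient of t^(k+2), on either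
-- side, is (-1)^k (n+k+4)! / ((k+2)!² (n+4-k)!) times a polynomial in k and n (reading
-- 1/(n+4-k)! as 0 for k > n+4), so the theorem reduces to a polynomial identity.  The
-- coefficients of t^0 and t^1 are checked directly.
module Submission where

open import Defs
open import Data.Nat using (ℕ; _≤_)
open import Relation.Binary.PropositionalEquality using (_≡_)

open import Data.Nat as ℕ using (zero; suc; _∸_; _<_; _!; z≤n; s≤s)
import Data.Nat.Properties as ℕP
open import Data.Nat.Properties using (_!≢0)
open import Data.Nat.Combinatorics using (_C_; nC1≡n; nCk+nC[k+1]≡[n+1]C[k+1])
import Data.Nat.Coprimality as Coprimality
import Data.Integer as ℤ
import Data.Integer.Properties as ℤP
open import Data.Rational using (ℚ; mkℚ; 0ℚ; 1ℚ; _+_; _*_; -_; _-_; _/_)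
import Data.Rational.Properties as ℚP
open import Data.List.Base using (_∷_; [])
open import Level using (0ℓ)
open import Relation.Binary.PropositionalEquality
  using (_≢_; refl; sym; trans; cong; cong₂; module ≡-Reasoning)
open import Relation.Nullary using (yes; no; contradiction)
open import Data.Bool using (true; false)
open import Function using (_∘_)
open import Relation.Nullary.Decidable.Core using (dec⇒maybe)
open import Tactic.RingSolver using (solve; solve-∀)
import Data.Nat.Tactic.RingSolver as ℕ-Ring
open import Tactic.RingSolver.Core.AlmostCommutativeRing
  using (AlmostCommutativeRing; fromCommutativeRing)

open ≡-Reasoning

ℚ-ring : AlmostCommutativeRing 0ℓ 0ℓ
ℚ-ring = fromCommutativeRing ℚP.+-*-commutativeRing (λ x → dec⇒maybe (0ℚ ℚP.≟ x))

ℕ→ℚ≡mkℚ : ∀ n → ℕ→ℚ n ≡ mkℚ (ℤ.+ n) 0 (Coprimality.sym (Coprimality.1-coprimeTo n))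
ℕ→ℚ≡mkℚ n = ℚP.normalize-coprime _

ℕ→ℚ-+ : ∀ m n → ℕ→ℚ (m ℕ.+ n) ≡ ℕ→ℚ m + ℕ→ℚ n
ℕ→ℚ-+ m n rewrite ℕ→ℚ≡mkℚ m | ℕ→ℚ≡mkℚ n = ℚP./-cong {p₁ = ℤ.+ (m ℕ.+ n)}
  (trans (ℤP.pos-+ m n) (sym (cong₂ ℤ._+_ (ℤP.*-identityʳ (ℤ.+ m)) (ℤP.*-identityʳ (ℤ.+ n)))))
  refl

ℕ→ℚ-* : ∀ m n → ℕ→ℚ (m ℕ.* n) ≡ ℕ→ℚ m * ℕ→ℚ n
ℕ→ℚ-* m n rewrite ℕ→ℚ≡mkℚ m | ℕ→ℚ≡mkℚ n = ℚP./-cong {p₁ = ℤ.+ (m ℕ.* n)} (ℤP.pos-* m n) refl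

1/n*n≡1 : ∀ n .{{_ : ℕ.NonZero n}} → ((ℤ.+ 1) / n) * ℕ→ℚ n ≡ 1ℚ
1/n*n≡1 (suc n) =
  trans (cong₂ _*_ (ℚP.normalize-coprime (Coprimality.1-coprimeTo (suc n))) (ℕ→ℚ≡mkℚ (suc n)))
        (ℚP.*-inverseˡ (mkℚ (ℤ.+ suc n) 0 (Coprimality.sym (Coprimality.1-coprimeTo (suc n)))))

1/n*[n*x]≡x : ∀ n .{{_ : ℕ.NonZero n}} x → ((ℤ.+ 1) / n) * (ℕ→ℚ n * x) ≡ x
1/n*[n*x]≡x n x = begin
  ((ℤ.+ 1) / n) * (ℕ→ℚ n * x) ≡⟨ sym (ℚP.*-assoc ((ℤ.+ 1) / n) (ℕ→ℚ n) x) ⟩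
  ((ℤ.+ 1) / n) * ℕ→ℚ n * x   ≡⟨ cong (_* x) (1/n*n≡1 n) ⟩
  1ℚ * x                      ≡⟨ ℚP.*-identityˡ x ⟩
  x                           ∎

ℕ→ℚ-affine : ∀ a b n {m} → m ≡ a ℕ.+ b ℕ.* n → ℕ→ℚ m ≡ ℕ→ℚ a + ℕ→ℚ b * ℕ→ℚ n
ℕ→ℚ-affine a b n refl = trans (ℕ→ℚ-+ a (b ℕ.* n)) (cong (ℕ→ℚ a +_) (ℕ→ℚ-* b n))

sumTo-cong : ∀ n {f g : ℕ → ℚ} → (∀ i → f i ≡ g i) → sumTo n f ≡ sumTo n g
sumTo-cong zero    f≡g = f≡g 0
sumTo-cong (suc n) f≡g = cong₂ _+_ (sumTo-cong n f≡g) (f≡g (suc n))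

sumTo-+ : ∀ n (f g : ℕ → ℚ) → sumTo n (λ i → f i + g i) ≡ sumTo n f + sumTo n g
sumTo-+ zero    f g = refl
sumTo-+ (suc n) f g = begin
  sumTo n (λ i → f i + g i) + (f (suc n) + g (suc n))
    ≡⟨ cong (_+ (f (suc n) + g (suc n))) (sumTo-+ n f g) ⟩
  (sumTo n f + sumTo n g) + (f (suc n) + g (suc n))
    ≡⟨ interchange (sumTo n f) (sumTo n g) (f (suc n)) (g (suc n)) ⟩
  (sumTo n f + f (suc n)) + (sumTo n g + g (suc n)) ∎
  where
  interchange : ∀ a b c d → (a + b) + (c + d) ≡ (a + c) + (b + d)
  interchange = solve-∀ ℚ-ring

sumTo-≡0 : ∀ n (f : ℕ → ℚ) → (∀ i → i ≤ n → f i ≡ 0ℚ) → sumTo n f ≡ 0ℚ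
sumTo-≡0 zero    f f≡0 = f≡0 0 z≤n
sumTo-≡0 (suc n) f f≡0 =
  cong₂ _+_ (sumTo-≡0 n f (λ i i≤n → f≡0 i (ℕP.m≤n⇒m≤1+n i≤n))) (f≡0 (suc n) ℕP.≤-refl)

sumTo-single : ∀ n j (f : ℕ → ℚ) → j ≤ n → (∀ i → i ≤ n → i ≢ j → f i ≡ 0ℚ) → sumTo n f ≡ f j
sumTo-single zero    zero f _ _ = refl
sumTo-single (suc n) j f j≤1+n f≡0 with j ℕP.≟ suc n
... | yes refl = begin
  sumTo n f + f (suc n) ≡⟨ cong (_+ f (suc n)) (sumTo-≡0 n f (λ i i≤n → f≡0' i≤n)) ⟩
  0ℚ + f (suc n)        ≡⟨ ℚP.+-identityˡ (f (suc n)) ⟩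
  f (suc n)             ∎
  where
  f≡0' : ∀ {i} → i ≤ n → f i ≡ 0ℚ
  f≡0' {i} i≤n = f≡0 i (ℕP.m≤n⇒m≤1+n i≤n) (ℕP.<⇒≢ (s≤s i≤n))
... | no j≢1+n = begin
  sumTo n f + f (suc n) ≡⟨ cong₂ _+_ (sumTo-single n j f j≤n f≡0') (f≡0 (suc n) ℕP.≤-refl (j≢1+n ∘ sym)) ⟩
  f j + 0ℚ              ≡⟨ ℚP.+-identityʳ (f j) ⟩
  f j                   ∎
  where
  j≤n : j ≤ n
  j≤n = ℕP.≤-pred (ℕP.≤∧≢⇒< j≤1+n j≢1+n)
  f≡0' : ∀ i → i ≤ n → i ≢ j → f i ≡ 0ℚ
  f≡0' i i≤n = f≡0 i (ℕP.m≤n⇒m≤1+n i≤n)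

mono-≡ : ∀ c j → mono c j j ≡ c
mono-≡ c j with j ℕ.≡ᵇ j | ℕP.≡⇒≡ᵇ j j refl
... | true | _ = refl

mono-≢ : ∀ c {j i} → i ≢ j → mono c j i ≡ 0ℚ
mono-≢ c {j} {i} i≢j with i ℕ.≡ᵇ j | ℕP.≡ᵇ⇒≡ i j
... | false | _   = refl
... | true  | i≡j = contradiction (i≡j _) i≢j

_↑_ : Poly → ℕ → Poly
(p ↑ zero)  k       = p k
(p ↑ suc j) zero    = 0ℚ
(p ↑ suc j) (suc k) = (p ↑ j) k

↑-≤ : ∀ p {j k} → j ≤ k → (p ↑ j) k ≡ p (k ∸ j)
↑-≤ p z≤n       = refl
↑-≤ p (s≤s j≤k) = ↑-≤ p j≤k

↑-< : ∀ p {j k} → k < j → (p ↑ j) k ≡ 0ℚ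
↑-< p {suc j} {zero}  _         = refl
↑-< p {suc j} {suc k} (s≤s k<j) = ↑-< p k<j

mono-⊛ : ∀ c j p k → (mono c j ⊛ p) k ≡ c * (p ↑ j) k
mono-⊛ c j p k with j ℕP.≤? k
... | yes j≤k = begin
  sumTo k (λ i → mono c j i * p (k ∸ i)) ≡⟨ sumTo-single k j _ j≤k (λ i _ i≢j → off-diagonal i≢j) ⟩
  mono c j j * p (k ∸ j)                  ≡⟨ cong₂ _*_ (mono-≡ c j) (sym (↑-≤ p j≤k)) ⟩
  c * (p ↑ j) k                           ∎
  where
  off-diagonal : ∀ {i} → i ≢ j → mono c j i * p (k ∸ i) ≡ 0ℚ
  off-diagonal {i} i≢j = trans (cong (_* p (k ∸ i)) (mono-≢ c i≢j)) (ℚP.*-zeroˡ (p (k ∸ i)))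
... | no j≰k = begin
  sumTo k (λ i → mono c j i * p (k ∸ i)) ≡⟨ sumTo-≡0 k _ (λ i i≤k → vanishing i≤k) ⟩
  0ℚ                                      ≡⟨ sym (ℚP.*-zeroʳ c) ⟩
  c * 0ℚ                                  ≡⟨ cong (c *_) (sym (↑-< p k<j)) ⟩
  c * (p ↑ j) k                           ∎
  where
  k<j : k < j
  k<j = ℕP.≰⇒> j≰k
  vanishing : ∀ {i} → i ≤ k → mono c j i * p (k ∸ i) ≡ 0ℚ
  vanishing {i} i≤k = trans (cong (_* p (k ∸ i)) (mono-≢ c (ℕP.<⇒≢ (ℕP.≤-<-trans i≤k k<j))))
                            (ℚP.*-zeroˡ (p (k ∸ i)))

⊛-mono : ∀ c j p k → (p ⊛ mono c j) k ≡ (p ↑ j) k * c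
⊛-mono c j p k with j ℕP.≤? k
... | yes j≤k = begin
  sumTo k (λ i → p i * mono c j (k ∸ i))
    ≡⟨ sumTo-single k (k ∸ j) _ (ℕP.m∸n≤m k j) (λ i i≤k i≢k∸j → off-diagonal i≤k i≢k∸j) ⟩
  p (k ∸ j) * mono c j (k ∸ (k ∸ j))
    ≡⟨ cong₂ _*_ (sym (↑-≤ p j≤k)) (trans (cong (mono c j) (ℕP.m∸[m∸n]≡n j≤k)) (mono-≡ c j)) ⟩
  (p ↑ j) k * c                           ∎
  where
  off-diagonal : ∀ {i} → i ≤ k → i ≢ k ∸ j → p i * mono c j (k ∸ i) ≡ 0ℚ
  off-diagonal {i} i≤k i≢k∸j = trans (cong (p i *_) (mono-≢ c k∸i≢j)) (ℚP.*-zeroʳ (p i))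
    where
    k∸i≢j : k ∸ i ≢ j
    k∸i≢j k∸i≡j = i≢k∸j (trans (sym (ℕP.m∸[m∸n]≡n i≤k)) (cong (k ∸_) k∸i≡j))
... | no j≰k = begin
  sumTo k (λ i → p i * mono c j (k ∸ i)) ≡⟨ sumTo-≡0 k _ (λ i _ → vanishing i) ⟩
  0ℚ                                      ≡⟨ sym (ℚP.*-zeroˡ c) ⟩
  0ℚ * c                                  ≡⟨ cong (_* c) (sym (↑-< p k<j)) ⟩
  (p ↑ j) k * c                           ∎
  where
  k<j : k < j
  k<j = ℕP.≰⇒> j≰k
  vanishing : ∀ i → p i * mono c j (k ∸ i) ≡ 0ℚ
  vanishing i = trans (cong (p i *_) (mono-≢ c (ℕP.<⇒≢ (ℕP.≤-<-trans (ℕP.m∸n≤m k i) k<j))))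
                      (ℚP.*-zeroʳ (p i))

⊛-distribˡ-⊕ : ∀ p q r k → (p ⊛ (q ⊕ r)) k ≡ (p ⊛ q) k + (p ⊛ r) k
⊛-distribˡ-⊕ p q r k =
  trans (sumTo-cong k (λ i → ℚP.*-distribˡ-+ (p i) (q (k ∸ i)) (r (k ∸ i)))) (sumTo-+ k _ _)

⊛-distribʳ-⊕ : ∀ p q r k → ((q ⊕ r) ⊛ p) k ≡ (q ⊛ p) k + (r ⊛ p) k
⊛-distribʳ-⊕ p q r k =
  trans (sumTo-cong k (λ i → ℚP.*-distribʳ-+ (p (k ∸ i)) (q i) (r i))) (sumTo-+ k _ _)

_!⁻¹ : ℕ → ℚ
n !⁻¹ = ((ℤ.+ 1) / n !) {{n !≢0}}

n!⁻¹*n!≡1 : ∀ n → n !⁻¹ * ℕ→ℚ (n !) ≡ 1ℚ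
n!⁻¹*n!≡1 n = 1/n*n≡1 (n !) {{n !≢0}}

ℕ→ℚ-! : ∀ n → ℕ→ℚ (suc n !) ≡ ℕ→ℚ (suc n) * ℕ→ℚ (n !)
ℕ→ℚ-! n = ℕ→ℚ-* (suc n) (n !)

ℕ→ℚ-!-+ : ∀ c m → ℕ→ℚ ((suc c ℕ.+ m) !) ≡ (ℕ→ℚ (suc c) + ℕ→ℚ m) * ℕ→ℚ ((c ℕ.+ m) !)
ℕ→ℚ-!-+ c m = trans (ℕ→ℚ-! (c ℕ.+ m)) (cong (_* ℕ→ℚ ((c ℕ.+ m) !)) (ℕ→ℚ-+ (suc c) m))

!⁻¹-suc : ∀ n → n !⁻¹ ≡ ℕ→ℚ (suc n) * suc n !⁻¹
!⁻¹-suc n = begin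
  n !⁻¹                                          ≡⟨ sym (ℚP.*-identityʳ (n !⁻¹)) ⟩
  n !⁻¹ * 1ℚ                                     ≡⟨ cong (n !⁻¹ *_) (sym (n!⁻¹*n!≡1 (suc n))) ⟩
  n !⁻¹ * (suc n !⁻¹ * ℕ→ℚ (suc n !))            ≡⟨ cong (λ f → n !⁻¹ * (suc n !⁻¹ * f)) (ℕ→ℚ-! n) ⟩
  n !⁻¹ * (suc n !⁻¹ * (ℕ→ℚ (suc n) * ℕ→ℚ (n !))) ≡⟨ regroup (n !⁻¹) (suc n !⁻¹) (ℕ→ℚ (suc n)) (ℕ→ℚ (n !)) ⟩
  (n !⁻¹ * ℕ→ℚ (n !)) * (ℕ→ℚ (suc n) * suc n !⁻¹) ≡⟨ cong (_* (ℕ→ℚ (suc n) * suc n !⁻¹)) (n!⁻¹*n!≡1 n) ⟩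
  1ℚ * (ℕ→ℚ (suc n) * suc n !⁻¹)                 ≡⟨ ℚP.*-identityˡ _ ⟩
  ℕ→ℚ (suc n) * suc n !⁻¹                        ∎
  where
  regroup : ∀ a b c d → a * (b * (c * d)) ≡ (a * d) * (c * b)
  regroup = solve-∀ ℚ-ring

derivIter-coeff : ∀ m p i → derivIter m p i ≡ ℕ→ℚ ((i ℕ.+ m) !) * i !⁻¹ * p (m ℕ.+ i)
derivIter-coeff zero p i = begin
  p i                                    ≡⟨ sym (ℚP.*-identityˡ (p i)) ⟩
  1ℚ * p i                               ≡⟨ cong (_* p i) (sym (trans (ℚP.*-comm _ (i !⁻¹)) (n!⁻¹*n!≡1 i))) ⟩
  ℕ→ℚ (i !) * i !⁻¹ * p i                ≡⟨ cong (λ m → ℕ→ℚ (m !) * i !⁻¹ * p i) (sym (ℕP.+-identityʳ i)) ⟩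
  ℕ→ℚ ((i ℕ.+ 0) !) * i !⁻¹ * p i        ∎
derivIter-coeff (suc m) p i = begin
  ℕ→ℚ (suc i) * derivIter m p (suc i)
    ≡⟨ cong (ℕ→ℚ (suc i) *_) (derivIter-coeff m p (suc i)) ⟩
  ℕ→ℚ (suc i) * (ℕ→ℚ (suc (i ℕ.+ m) !) * suc i !⁻¹ * p (m ℕ.+ suc i))
    ≡⟨ regroup (ℕ→ℚ (suc i)) (ℕ→ℚ (suc (i ℕ.+ m) !)) (suc i !⁻¹) (p (m ℕ.+ suc i)) ⟩
  ℕ→ℚ (suc (i ℕ.+ m) !) * (ℕ→ℚ (suc i) * suc i !⁻¹) * p (m ℕ.+ suc i)
    ≡⟨ cong₂ (λ f q → ℕ→ℚ (f !) * q * p (m ℕ.+ suc i)) (sym (ℕP.+-suc i m)) (sym (!⁻¹-suc i)) ⟩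
  ℕ→ℚ ((i ℕ.+ suc m) !) * i !⁻¹ * p (m ℕ.+ suc i)
    ≡⟨ cong (λ j → ℕ→ℚ ((i ℕ.+ suc m) !) * i !⁻¹ * p j) (ℕP.+-suc m i) ⟩
  ℕ→ℚ ((i ℕ.+ suc m) !) * i !⁻¹ * p (suc m ℕ.+ i) ∎
  where
  regroup : ∀ a f b q → a * (f * b * q) ≡ f * (a * b) * q
  regroup = solve-∀ ℚ-ring

derivIter-t^m⊛ : ∀ m p i → derivIter m (mono 1ℚ m ⊛ p) i ≡ ℕ→ℚ ((i ℕ.+ m) !) * i !⁻¹ * p i
derivIter-t^m⊛ m p i = trans (derivIter-coeff m (mono 1ℚ m ⊛ p) i) (cong (ℕ→ℚ ((i ℕ.+ m) !) * i !⁻¹ *_) (begin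
  (mono 1ℚ m ⊛ p) (m ℕ.+ i) ≡⟨ mono-⊛ 1ℚ m p (m ℕ.+ i) ⟩
  1ℚ * (p ↑ m) (m ℕ.+ i)    ≡⟨ ℚP.*-identityˡ ((p ↑ m) (m ℕ.+ i)) ⟩
  (p ↑ m) (m ℕ.+ i)         ≡⟨ ↑-≤ p (ℕP.m≤m+n m i) ⟩
  p (m ℕ.+ i ∸ m)           ≡⟨ cong p (ℕP.m+n∸m≡n m i) ⟩
  p i                       ∎))

-- [ n ∸ k ]!⁻¹ is 1/(n-k)! for k ≤ n, but 0 (not 1/0!) for k > n, just as n C k vanishes there.
[_∸_]!⁻¹ : ℕ → ℕ → ℚ
[ n     ∸ zero  ]!⁻¹ = n !⁻¹
[ zero  ∸ suc k ]!⁻¹ = 0ℚ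
[ suc n ∸ suc k ]!⁻¹ = [ n ∸ k ]!⁻¹

ℕ→ℚ-suc-suc : ∀ m n → ℕ→ℚ (suc m) - ℕ→ℚ (suc n) ≡ ℕ→ℚ m - ℕ→ℚ n
ℕ→ℚ-suc-suc m n = begin
  ℕ→ℚ (suc m) - ℕ→ℚ (suc n)           ≡⟨ cong₂ _-_ (ℕ→ℚ-+ 1 m) (ℕ→ℚ-+ 1 n) ⟩
  (1ℚ + ℕ→ℚ m) - (1ℚ + ℕ→ℚ n)          ≡⟨ cancel (ℕ→ℚ m) (ℕ→ℚ n) ⟩
  ℕ→ℚ m - ℕ→ℚ n                        ∎
  where
  cancel : ∀ a b → (1ℚ + a) - (1ℚ + b) ≡ a - b
  cancel = solve-∀ ℚ-ring

[∸suc]!⁻¹ : ∀ n k → [ n ∸ suc k ]!⁻¹ ≡ (ℕ→ℚ n - ℕ→ℚ k) * [ n ∸ k ]!⁻¹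
[∸suc]!⁻¹ zero    zero    = refl
[∸suc]!⁻¹ zero    (suc k) = sym (ℚP.*-zeroʳ (ℕ→ℚ 0 - ℕ→ℚ (suc k)))
[∸suc]!⁻¹ (suc n) zero    = trans (!⁻¹-suc n) (cong (_* suc n !⁻¹) (sym (ℚP.+-identityʳ (ℕ→ℚ (suc n)))))
[∸suc]!⁻¹ (suc n) (suc k) = trans ([∸suc]!⁻¹ n k) (cong (_* [ n ∸ k ]!⁻¹) (sym (ℕ→ℚ-suc-suc n k)))

[n+m∸n]!⁻¹ : ∀ n m → [ n ℕ.+ m ∸ n ]!⁻¹ ≡ m !⁻¹
[n+m∸n]!⁻¹ zero    m = refl
[n+m∸n]!⁻¹ (suc n) m = [n+m∸n]!⁻¹ n m

nCk≡n!*k!⁻¹*[n∸k]!⁻¹ : ∀ n k → ℕ→ℚ (n C k) ≡ ℕ→ℚ (n !) * k !⁻¹ * [ n ∸ k ]!⁻¹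
nCk≡n!*k!⁻¹*[n∸k]!⁻¹ n       zero    = sym (begin
  ℕ→ℚ (n !) * 1ℚ * n !⁻¹ ≡⟨ cong (_* n !⁻¹) (ℚP.*-identityʳ (ℕ→ℚ (n !))) ⟩
  ℕ→ℚ (n !) * n !⁻¹      ≡⟨ ℚP.*-comm (ℕ→ℚ (n !)) (n !⁻¹) ⟩
  n !⁻¹ * ℕ→ℚ (n !)      ≡⟨ n!⁻¹*n!≡1 n ⟩
  1ℚ                     ∎)
nCk≡n!*k!⁻¹*[n∸k]!⁻¹ zero    (suc k) = sym (ℚP.*-zeroʳ (1ℚ * suc k !⁻¹))
nCk≡n!*k!⁻¹*[n∸k]!⁻¹ (suc n) (suc k) = begin
  ℕ→ℚ (suc n C suc k)
    ≡⟨ cong ℕ→ℚ (sym (nCk+nC[k+1]≡[n+1]C[k+1] n k)) ⟩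
  ℕ→ℚ (n C k ℕ.+ n C suc k)
    ≡⟨ ℕ→ℚ-+ (n C k) (n C suc k) ⟩
  ℕ→ℚ (n C k) + ℕ→ℚ (n C suc k)
    ≡⟨ cong₂ _+_ (nCk≡n!*k!⁻¹*[n∸k]!⁻¹ n k) (nCk≡n!*k!⁻¹*[n∸k]!⁻¹ n (suc k)) ⟩
  f * k !⁻¹ * g + f * suc k !⁻¹ * [ n ∸ suc k ]!⁻¹
    ≡⟨ cong₂ (λ a b → f * a * g + f * suc k !⁻¹ * b) (!⁻¹-suc k) ([∸suc]!⁻¹ n k) ⟩
  f * (ℕ→ℚ (suc k) * J) * g + f * J * ((ℕ→ℚ n - ℕ→ℚ k) * g)
    ≡⟨ cong (λ a → f * (a * J) * g + f * J * ((ℕ→ℚ n - ℕ→ℚ k) * g)) (ℕ→ℚ-+ 1 k) ⟩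
  f * ((1ℚ + ℕ→ℚ k) * J) * g + f * J * ((ℕ→ℚ n - ℕ→ℚ k) * g)
    ≡⟨ collect f J g (ℕ→ℚ n) (ℕ→ℚ k) ⟩
  (1ℚ + ℕ→ℚ n) * f * J * g
    ≡⟨ cong (λ a → a * f * J * g) (sym (ℕ→ℚ-+ 1 n)) ⟩
  ℕ→ℚ (suc n) * f * J * g
    ≡⟨ cong (λ a → a * J * g) (sym (ℕ→ℚ-! n)) ⟩
  ℕ→ℚ (suc n !) * J * g ∎
  where
  f g J : ℚ
  f = ℕ→ℚ (n !)
  g = [ n ∸ k ]!⁻¹
  J = suc k !⁻¹
  collect : ∀ f J g a b → f * ((1ℚ + b) * J) * g + f * J * ((a - b) * g) ≡ (1ℚ + a) * f * J * g
  collect = solve-∀ ℚ-ring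

n!⁻¹*nCk≡k!⁻¹*[n∸k]!⁻¹ : ∀ n k → n !⁻¹ * ℕ→ℚ (n C k) ≡ k !⁻¹ * [ n ∸ k ]!⁻¹
n!⁻¹*nCk≡k!⁻¹*[n∸k]!⁻¹ n k = begin
  n !⁻¹ * ℕ→ℚ (n C k)                           ≡⟨ cong (n !⁻¹ *_) (nCk≡n!*k!⁻¹*[n∸k]!⁻¹ n k) ⟩
  n !⁻¹ * (ℕ→ℚ (n !) * k !⁻¹ * [ n ∸ k ]!⁻¹)    ≡⟨ regroup (n !⁻¹) (ℕ→ℚ (n !)) (k !⁻¹) [ n ∸ k ]!⁻¹ ⟩
  n !⁻¹ * ℕ→ℚ (n !) * (k !⁻¹ * [ n ∸ k ]!⁻¹)    ≡⟨ cong (_* (k !⁻¹ * [ n ∸ k ]!⁻¹)) (n!⁻¹*n!≡1 n) ⟩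
  1ℚ * (k !⁻¹ * [ n ∸ k ]!⁻¹)                   ≡⟨ ℚP.*-identityˡ _ ⟩
  k !⁻¹ * [ n ∸ k ]!⁻¹                          ∎
  where
  regroup : ∀ a f j g → a * (f * j * g) ≡ a * f * (j * g)
  regroup = solve-∀ ℚ-ring

fB-via-factorials : ∀ n k → fB n k ≡ sgn k * (ℕ→ℚ ((n ℕ.+ k) !) * (k !⁻¹ * k !⁻¹) * [ n ∸ k ]!⁻¹)
fB-via-factorials n k = cong (sgn k *_) (begin
  ℕ→ℚ ((n C k) ℕ.* ((n ℕ.+ k) C k))
    ≡⟨ ℕ→ℚ-* (n C k) ((n ℕ.+ k) C k) ⟩
  ℕ→ℚ (n C k) * ℕ→ℚ ((n ℕ.+ k) C k)
    ≡⟨ cong₂ _*_ (nCk≡n!*k!⁻¹*[n∸k]!⁻¹ n k) (nCk≡n!*k!⁻¹*[n∸k]!⁻¹ (n ℕ.+ k) k) ⟩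
  ℕ→ℚ (n !) * k !⁻¹ * g * (ℕ→ℚ ((n ℕ.+ k) !) * k !⁻¹ * [ n ℕ.+ k ∸ k ]!⁻¹)
    ≡⟨ cong (λ m → ℕ→ℚ (n !) * k !⁻¹ * g * (ℕ→ℚ ((n ℕ.+ k) !) * k !⁻¹ * [ m ∸ k ]!⁻¹)) (ℕP.+-comm n k) ⟩
  ℕ→ℚ (n !) * k !⁻¹ * g * (ℕ→ℚ ((n ℕ.+ k) !) * k !⁻¹ * [ k ℕ.+ n ∸ k ]!⁻¹)
    ≡⟨ cong (λ c → ℕ→ℚ (n !) * k !⁻¹ * g * (ℕ→ℚ ((n ℕ.+ k) !) * k !⁻¹ * c)) ([n+m∸n]!⁻¹ k n) ⟩
  ℕ→ℚ (n !) * k !⁻¹ * g * (ℕ→ℚ ((n ℕ.+ k) !) * k !⁻¹ * n !⁻¹)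
    ≡⟨ regroup (ℕ→ℚ (n !)) (k !⁻¹) g (ℕ→ℚ ((n ℕ.+ k) !)) (n !⁻¹) ⟩
  n !⁻¹ * ℕ→ℚ (n !) * (ℕ→ℚ ((n ℕ.+ k) !) * (k !⁻¹ * k !⁻¹) * g)
    ≡⟨ cong (_* (ℕ→ℚ ((n ℕ.+ k) !) * (k !⁻¹ * k !⁻¹) * g)) (n!⁻¹*n!≡1 n) ⟩
  1ℚ * (ℕ→ℚ ((n ℕ.+ k) !) * (k !⁻¹ * k !⁻¹) * g)
    ≡⟨ ℚP.*-identityˡ _ ⟩
  ℕ→ℚ ((n ℕ.+ k) !) * (k !⁻¹ * k !⁻¹) * g ∎)
  where
  g : ℚ
  g = [ n ∸ k ]!⁻¹
  regroup : ∀ f j g F i → f * j * g * (F * j * i) ≡ i * f * (F * (j * j) * g)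
  regroup = solve-∀ ℚ-ring

fB-1 : ∀ m → fB m 1 ≡ - 1ℚ * (ℕ→ℚ m * (ℕ→ℚ m + 1ℚ))
fB-1 m = cong (- 1ℚ *_) (begin
  ℕ→ℚ ((m C 1) ℕ.* ((m ℕ.+ 1) C 1)) ≡⟨ cong ℕ→ℚ (cong₂ ℕ._*_ (nC1≡n m) (nC1≡n (m ℕ.+ 1))) ⟩
  ℕ→ℚ (m ℕ.* (m ℕ.+ 1))            ≡⟨ ℕ→ℚ-* m (m ℕ.+ 1) ⟩
  ℕ→ℚ m * ℕ→ℚ (m ℕ.+ 1)            ≡⟨ cong (ℕ→ℚ m *_) (ℕ→ℚ-+ m 1) ⟩
  ℕ→ℚ m * (ℕ→ℚ m + 1ℚ)             ∎)

⊛-quadratic : ∀ p a b c i →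
  (p ⊛ (mono a 0 ⊕ (mono b 1 ⊕ mono c 2))) i ≡ p i * a + ((p ↑ 1) i * b + (p ↑ 2) i * c)
⊛-quadratic p a b c i = begin
  (p ⊛ (mono a 0 ⊕ (mono b 1 ⊕ mono c 2))) i
    ≡⟨ ⊛-distribˡ-⊕ p (mono a 0) (mono b 1 ⊕ mono c 2) i ⟩
  (p ⊛ mono a 0) i + (p ⊛ (mono b 1 ⊕ mono c 2)) i
    ≡⟨ cong₂ _+_ (⊛-mono a 0 p i) (⊛-distribˡ-⊕ p (mono b 1) (mono c 2) i) ⟩
  p i * a + ((p ⊛ mono b 1) i + (p ⊛ mono c 2) i)
    ≡⟨ cong (p i * a +_) (cong₂ _+_ (⊛-mono b 1 p i) (⊛-mono c 2 p i)) ⟩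
  p i * a + ((p ↑ 1) i * b + (p ↑ 2) i * c) ∎

fDplus-coeff : ∀ l i →
  let m = l ∸ 2; b = ℕ→ℚ (3 ℕ.* l ∸ 4); p = oneMinusTPow m in
  fDplus l i ≡ m !⁻¹ * (ℕ→ℚ ((i ℕ.+ (l ∸ 3)) !) * i !⁻¹ * (p i * ℕ→ℚ m + ((p ↑ 1) i * - b + (p ↑ 2) i * b)))
fDplus-coeff l i = cong ((l ∸ 2) !⁻¹ *_) (trans
  (derivIter-t^m⊛ (l ∸ 3) (oneMinusTPow (l ∸ 2) ⊛ quadratic) i)
  (cong (ℕ→ℚ ((i ℕ.+ (l ∸ 3)) !) * i !⁻¹ *_) (⊛-quadratic (oneMinusTPow (l ∸ 2)) _ _ _ i)))
  where
  quadratic : Poly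
  quadratic = mono (ℕ→ℚ (l ∸ 2)) 0 ⊕ (mono (- ℕ→ℚ (3 ℕ.* l ∸ 4)) 1 ⊕ mono (ℕ→ℚ (3 ℕ.* l ∸ 4)) 2)

rhs8p10-coeff : ∀ l (h : 5 ≤ l) i →
  let H = ((ℤ.+ 1) / (2 ℕ.* (l ∸ 1))) {{nz8p10 h}}; p = fB l; q = fB (l ∸ 1) in
  rhs8p10 l h i ≡ H * (ℕ→ℚ l * (p ↑ 1) i + - ℕ→ℚ 2 * p i)
                + H * (ℕ→ℚ (2 ℕ.* (2 ℕ.* l ∸ 1)) * (q ↑ 2) i + (- ℕ→ℚ (5 ℕ.* l) * (q ↑ 1) i + ℕ→ℚ (2 ℕ.* l) * q i))
rhs8p10-coeff l h i = cong₂ (λ u v → H * u + H * v)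
  (trans (⊛-distribʳ-⊕ p (mono (ℕ→ℚ l) 1) (mono (- ℕ→ℚ 2) 0) i)
         (cong₂ _+_ (mono-⊛ (ℕ→ℚ l) 1 p i) (mono-⊛ (- ℕ→ℚ 2) 0 p i)))
  (trans (⊛-distribʳ-⊕ q (mono c₂ 2) (mono (- c₁) 1 ⊕ mono c₀ 0) i)
         (cong₂ _+_ (mono-⊛ c₂ 2 q i)
                    (trans (⊛-distribʳ-⊕ q (mono (- c₁) 1) (mono c₀ 0) i)
                           (cong₂ _+_ (mono-⊛ (- c₁) 1 q i) (mono-⊛ c₀ 0 q i)))))
  where
  H c₂ c₁ c₀ : ℚ
  H = ((ℤ.+ 1) / (2 ℕ.* (l ∸ 1))) {{nz8p10 h}}
  c₂ = ℕ→ℚ (2 ℕ.* (2 ℕ.* l ∸ 1))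
  c₁ = ℕ→ℚ (5 ℕ.* l)
  c₀ = ℕ→ℚ (2 ℕ.* l)
  p q : Poly
  p = fB l
  q = fB (l ∸ 1)

coefficient-identity-0 : ∀ y H cl c₂ c₁ {c₀ d} →
  c₀ ≡ ℕ→ℚ 10 + ℕ→ℚ 2 * y → d ≡ ℕ→ℚ 8 + ℕ→ℚ 2 * y →
  H * (cl * 0ℚ + - ℕ→ℚ 2 * (1ℚ * 1ℚ)) + H * (c₂ * 0ℚ + (- c₁ * 0ℚ + c₀ * (1ℚ * 1ℚ))) ≡ H * (d * 1ℚ)
coefficient-identity-0 y H cl c₂ c₁ refl refl = solve (y ∷ H ∷ cl ∷ c₂ ∷ c₁ ∷ []) ℚ-ring

coefficient-identity-1 : ∀ y H c₂ {a b cl c₁ c₀ d L} →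
  a ≡ ℕ→ℚ 3 + y → b ≡ ℕ→ℚ 11 + ℕ→ℚ 3 * y → cl ≡ ℕ→ℚ 5 + y → c₁ ≡ ℕ→ℚ 25 + ℕ→ℚ 5 * y →
  c₀ ≡ ℕ→ℚ 10 + ℕ→ℚ 2 * y → d ≡ ℕ→ℚ 8 + ℕ→ℚ 2 * y → L ≡ ℕ→ℚ 4 + y →
  H * (cl * (1ℚ * 1ℚ) + - ℕ→ℚ 2 * (- 1ℚ * (cl * (cl + 1ℚ))))
    + H * (c₂ * 0ℚ + (- c₁ * (1ℚ * 1ℚ) + c₀ * (- 1ℚ * (L * (L + 1ℚ)))))
  ≡ H * (d * - (a * a + b))
coefficient-identity-1 y H c₂ refl refl refl refl refl refl refl = solve (y ∷ H ∷ c₂ ∷ []) ℚ-ring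

-- With l = n+5 and i = k+2, the variables stand for F_j = (n+k+j)!, J_j = 1/(k+j)!,
-- G_j = 1/(n+j-k)!, and F = F₄, J = J₂, G = G₄.
coefficient-identity-2+k : ∀ s x y H {F J G a b cl c₂ c₁ c₀ d F₅ F₆ F₇ J₁ J₀ G₃ G₂ G₁} →
  a ≡ ℕ→ℚ 3 + y → b ≡ ℕ→ℚ 11 + ℕ→ℚ 3 * y → cl ≡ ℕ→ℚ 5 + y →
  c₂ ≡ ℕ→ℚ 18 + ℕ→ℚ 4 * y → c₁ ≡ ℕ→ℚ 25 + ℕ→ℚ 5 * y → c₀ ≡ ℕ→ℚ 10 + ℕ→ℚ 2 * y →
  d ≡ ℕ→ℚ 8 + ℕ→ℚ 2 * y →
  F₅ ≡ (ℕ→ℚ 5 + (y + x)) * F → F₆ ≡ (ℕ→ℚ 6 + (y + x)) * F₅ → F₇ ≡ (ℕ→ℚ 7 + (y + x)) * F₆ →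
  J₁ ≡ (ℕ→ℚ 2 + x) * J → J₀ ≡ (ℕ→ℚ 1 + x) * J₁ →
  G₃ ≡ (ℕ→ℚ 4 + y - x) * G → G₂ ≡ (ℕ→ℚ 3 + y - x) * G₃ → G₁ ≡ (ℕ→ℚ 2 + y - x) * G₂ →
  H * (cl * (- s * (F₆ * (J₁ * J₁) * G)) + - ℕ→ℚ 2 * (- - s * (F₇ * (J * J) * G₃)))
    + H * (c₂ * (s * (F * (J₀ * J₀) * G))
           + (- c₁ * (- s * (F₅ * (J₁ * J₁) * G₃)) + c₀ * (- - s * (F₆ * (J * J) * G₂))))
  ≡ H * (d * (s * F * J * (a * (J * G₁) + b * (J₁ * G₂ + J₀ * G₃))))
coefficient-identity-2+k s x y H {F} {J} {G}
  refl refl refl refl refl refl refl refl refl refl refl refl refl refl refl =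
  solve (s ∷ x ∷ y ∷ H ∷ F ∷ J ∷ G ∷ []) ℚ-ring

module Coefficients (n : ℕ) where

  l : ℕ
  l = 5 ℕ.+ n

  y a b c₂ c₁ c₀ D H : ℚ
  y  = ℕ→ℚ n
  a  = ℕ→ℚ (l ∸ 2)
  b  = ℕ→ℚ (3 ℕ.* l ∸ 4)
  c₂ = ℕ→ℚ (2 ℕ.* (2 ℕ.* l ∸ 1))
  c₁ = ℕ→ℚ (5 ℕ.* l)
  c₀ = ℕ→ℚ (2 ℕ.* l)
  D  = ℕ→ℚ (2 ℕ.* (l ∸ 1))
  H  = (ℤ.+ 1) / (2 ℕ.* (l ∸ 1))

  ⟦l⟧ : ℕ→ℚ l ≡ ℕ→ℚ 5 + y
  ⟦l⟧ = ℕ→ℚ-+ 5 n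

  ⟦l∸1⟧ : ℕ→ℚ (l ∸ 1) ≡ ℕ→ℚ 4 + y
  ⟦l∸1⟧ = ℕ→ℚ-+ 4 n

  ⟦l∸2⟧ : a ≡ ℕ→ℚ 3 + y
  ⟦l∸2⟧ = ℕ→ℚ-+ 3 n

  ⟦3l∸4⟧ : b ≡ ℕ→ℚ 11 + ℕ→ℚ 3 * y
  ⟦3l∸4⟧ = ℕ→ℚ-affine 11 3 n (cong (_∸ 4) (expand n))
    where
    expand : ∀ n → 3 ℕ.* (5 ℕ.+ n) ≡ 4 ℕ.+ (11 ℕ.+ 3 ℕ.* n)
    expand = ℕ-Ring.solve-∀

  ⟦2[2l∸1]⟧ : c₂ ≡ ℕ→ℚ 18 + ℕ→ℚ 4 * y
  ⟦2[2l∸1]⟧ = ℕ→ℚ-affine 18 4 n (trans (cong (λ m → 2 ℕ.* (m ∸ 1)) (expand₁ n)) (expand₂ n))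
    where
    expand₁ : ∀ n → 2 ℕ.* (5 ℕ.+ n) ≡ 1 ℕ.+ (9 ℕ.+ 2 ℕ.* n)
    expand₁ = ℕ-Ring.solve-∀
    expand₂ : ∀ n → 2 ℕ.* (9 ℕ.+ 2 ℕ.* n) ≡ 18 ℕ.+ 4 ℕ.* n
    expand₂ = ℕ-Ring.solve-∀

  ⟦5l⟧ : c₁ ≡ ℕ→ℚ 25 + ℕ→ℚ 5 * y
  ⟦5l⟧ = ℕ→ℚ-affine 25 5 n (expand n)
    where
    expand : ∀ n → 5 ℕ.* (5 ℕ.+ n) ≡ 25 ℕ.+ 5 ℕ.* n
    expand = ℕ-Ring.solve-∀

  ⟦2l⟧ : c₀ ≡ ℕ→ℚ 10 + ℕ→ℚ 2 * y
  ⟦2l⟧ = ℕ→ℚ-affine 10 2 n (expand n)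
    where
    expand : ∀ n → 2 ℕ.* (5 ℕ.+ n) ≡ 10 ℕ.+ 2 ℕ.* n
    expand = ℕ-Ring.solve-∀

  ⟦2[l∸1]⟧ : D ≡ ℕ→ℚ 8 + ℕ→ℚ 2 * y
  ⟦2[l∸1]⟧ = ℕ→ℚ-affine 8 2 n (expand n)
    where
    expand : ∀ n → 2 ℕ.* (4 ℕ.+ n) ≡ 8 ℕ.+ 2 ℕ.* n
    expand = ℕ-Ring.solve-∀

  module _ (k : ℕ) where

    F[_] : ℕ → ℚ
    F[ c ] = ℕ→ℚ ((c ℕ.+ (n ℕ.+ k)) !)

    x s F J J₁ J₀ G G₃ G₂ G₁ : ℚ
    x  = ℕ→ℚ k
    s  = sgn k
    F  = F[ 4 ]
    J  = (2 ℕ.+ k) !⁻¹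
    J₁ = (1 ℕ.+ k) !⁻¹
    J₀ = k !⁻¹
    G  = [ 4 ℕ.+ n ∸ k ]!⁻¹
    G₃ = [ 3 ℕ.+ n ∸ k ]!⁻¹
    G₂ = [ 2 ℕ.+ n ∸ k ]!⁻¹
    G₁ = [ 1 ℕ.+ n ∸ k ]!⁻¹

    F[suc] : ∀ c → F[ suc c ] ≡ (ℕ→ℚ (suc c) + (y + x)) * F[ c ]
    F[suc] c = trans (ℕ→ℚ-!-+ c (n ℕ.+ k)) (cong (λ z → (ℕ→ℚ (suc c) + z) * F[ c ]) (ℕ→ℚ-+ n k))

    J[suc] : ∀ c → (c ℕ.+ k) !⁻¹ ≡ (ℕ→ℚ (suc c) + x) * (suc c ℕ.+ k) !⁻¹
    J[suc] c = trans (!⁻¹-suc (c ℕ.+ k)) (cong (_* (suc c ℕ.+ k) !⁻¹) (ℕ→ℚ-+ (suc c) k))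

    G[suc] : ∀ c → [ c ℕ.+ n ∸ k ]!⁻¹ ≡ (ℕ→ℚ (suc c) + y - x) * [ suc c ℕ.+ n ∸ k ]!⁻¹
    G[suc] c = trans ([∸suc]!⁻¹ (suc c ℕ.+ n) k)
                     (cong (λ z → (z - x) * [ suc c ℕ.+ n ∸ k ]!⁻¹) (ℕ→ℚ-+ (suc c) n))

    fB-at : ∀ i j → fB (i ℕ.+ n) (j ℕ.+ k)
                    ≡ sgn (j ℕ.+ k) * (F[ i ℕ.+ j ] * ((j ℕ.+ k) !⁻¹ * (j ℕ.+ k) !⁻¹)
                                       * [ i ℕ.+ n ∸ j ℕ.+ k ]!⁻¹)
    fB-at i j = trans (fB-via-factorials (i ℕ.+ n) (j ℕ.+ k))
      (cong (λ m → sgn (j ℕ.+ k) * (ℕ→ℚ (m !) * ((j ℕ.+ k) !⁻¹ * (j ℕ.+ k) !⁻¹)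
                                     * [ i ℕ.+ n ∸ j ℕ.+ k ]!⁻¹))
            (interchange i n j k))
      where
      interchange : ∀ i n j k → i ℕ.+ n ℕ.+ (j ℕ.+ k) ≡ i ℕ.+ j ℕ.+ (n ℕ.+ k)
      interchange = ℕ-Ring.solve-∀

    coefficient-2+k : ℚ
    coefficient-2+k = s * F * J * (a * (J * G₁) + b * (J₁ * G₂ + J₀ * G₃))

    fDplus-2+k : fDplus l (2 ℕ.+ k) ≡ coefficient-2+k
    fDplus-2+k = begin
      fDplus l (2 ℕ.+ k)
        ≡⟨ fDplus-coeff l (2 ℕ.+ k) ⟩
      M * (P * J * ((- - s * binom (2 ℕ.+ k)) * a + ((- s * binom (1 ℕ.+ k)) * - b + (s * binom k) * b)))
        ≡⟨ pull-in M P J s a b (binom (2 ℕ.+ k)) (binom (1 ℕ.+ k)) (binom k) ⟩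
      s * P * J * (a * (M * binom (2 ℕ.+ k)) + b * (M * binom (1 ℕ.+ k) + M * binom k))
        ≡⟨ cong₂ (λ u v → s * u * J * v) (cong (λ m → ℕ→ℚ (m !)) (expand k n))
                 (cong₂ (λ u v → a * u + b * v) (binomial (2 ℕ.+ k))
                        (cong₂ _+_ (binomial (1 ℕ.+ k)) (binomial k))) ⟩
      coefficient-2+k ∎
      where
      M P : ℚ
      M = (l ∸ 2) !⁻¹
      P = ℕ→ℚ ((2 ℕ.+ k ℕ.+ (l ∸ 3)) !)
      binom : ℕ → ℚ
      binom j = ℕ→ℚ ((l ∸ 2) C j)
      binomial : ∀ j → M * binom j ≡ j !⁻¹ * [ 3 ℕ.+ n ∸ j ]!⁻¹
      binomial = n!⁻¹*nCk≡k!⁻¹*[n∸k]!⁻¹ (l ∸ 2)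
      expand : ∀ k n → 2 ℕ.+ k ℕ.+ (2 ℕ.+ n) ≡ 4 ℕ.+ (n ℕ.+ k)
      expand = ℕ-Ring.solve-∀
      pull-in : ∀ M P J s a b c₂ c₁ c₀ →
        M * (P * J * ((- - s * c₂) * a + ((- s * c₁) * - b + (s * c₀) * b)))
        ≡ s * P * J * (a * (M * c₂) + b * (M * c₁ + M * c₀))
      pull-in = solve-∀ ℚ-ring

    rhs8p10-2+k : ∀ h → rhs8p10 l h (2 ℕ.+ k) ≡ H * (D * coefficient-2+k)
    rhs8p10-2+k h = begin
      rhs8p10 l h (2 ℕ.+ k)
        ≡⟨ rhs8p10-coeff l h (2 ℕ.+ k) ⟩
      H * (ℕ→ℚ l * fB l (1 ℕ.+ k) + - ℕ→ℚ 2 * fB l (2 ℕ.+ k))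
        + H * (c₂ * fB (l ∸ 1) k + (- c₁ * fB (l ∸ 1) (1 ℕ.+ k) + c₀ * fB (l ∸ 1) (2 ℕ.+ k)))
        ≡⟨ cong₂ (λ u v → H * u + H * v)
             (cong₂ (λ u v → ℕ→ℚ l * u + - ℕ→ℚ 2 * v) (fB-at 5 1) (fB-at 5 2))
             (cong₂ (λ u v → c₂ * u + v) (fB-at 4 0)
                    (cong₂ (λ u v → - c₁ * u + c₀ * v) (fB-at 4 1) (fB-at 4 2))) ⟩
      H * (ℕ→ℚ l * (- s * (F[ 6 ] * (J₁ * J₁) * G)) + - ℕ→ℚ 2 * (- - s * (F[ 7 ] * (J * J) * G₃)))
        + H * (c₂ * (s * (F * (J₀ * J₀) * G))
               + (- c₁ * (- s * (F[ 5 ] * (J₁ * J₁) * G₃)) + c₀ * (- - s * (F[ 6 ] * (J * J) * G₂))))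
        ≡⟨ coefficient-identity-2+k s x y H ⟦l∸2⟧ ⟦3l∸4⟧ ⟦l⟧ ⟦2[2l∸1]⟧ ⟦5l⟧ ⟦2l⟧ ⟦2[l∸1]⟧
             (F[suc] 4) (F[suc] 5) (F[suc] 6) (J[suc] 1) (J[suc] 0) (G[suc] 3) (G[suc] 2) (G[suc] 1) ⟩
      H * (D * coefficient-2+k) ∎

  coefficient : ℕ → ℚ
  coefficient 0             = 1ℚ
  coefficient 1             = - (a * a + b)
  coefficient (suc (suc k)) = coefficient-2+k k

  fDplus-value : ∀ i → fDplus l i ≡ coefficient i
  fDplus-value 0 = begin
    fDplus l 0                                                     ≡⟨ fDplus-coeff l 0 ⟩
    M * (f * 1ℚ * ((1ℚ * 1ℚ) * a + (0ℚ * - b + 0ℚ * b)))           ≡⟨ collect M f a b ⟩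
    M * (a * f)                                                    ≡⟨ cong (M *_) (sym (ℕ→ℚ-! (2 ℕ.+ n))) ⟩
    M * ℕ→ℚ ((3 ℕ.+ n) !)                                          ≡⟨ n!⁻¹*n!≡1 (3 ℕ.+ n) ⟩
    1ℚ                                                             ∎
    where
    M f : ℚ
    M = (l ∸ 2) !⁻¹
    f = ℕ→ℚ ((2 ℕ.+ n) !)
    collect : ∀ M f a b → M * (f * 1ℚ * ((1ℚ * 1ℚ) * a + (0ℚ * - b + 0ℚ * b))) ≡ M * (a * f)
    collect = solve-∀ ℚ-ring
  fDplus-value 1 = begin
    fDplus l 1
      ≡⟨ fDplus-coeff l 1 ⟩
    M * (f * 1ℚ * ((- 1ℚ * ℕ→ℚ ((l ∸ 2) C 1)) * a + ((1ℚ * 1ℚ) * - b + 0ℚ * b)))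
      ≡⟨ cong (λ c → M * (f * 1ℚ * ((- 1ℚ * ℕ→ℚ c) * a + ((1ℚ * 1ℚ) * - b + 0ℚ * b)))) (nC1≡n (l ∸ 2)) ⟩
    M * (f * 1ℚ * ((- 1ℚ * a) * a + ((1ℚ * 1ℚ) * - b + 0ℚ * b)))
      ≡⟨ collect M f a b ⟩
    M * f * - (a * a + b)
      ≡⟨ cong (_* - (a * a + b)) (n!⁻¹*n!≡1 (l ∸ 2)) ⟩
    1ℚ * - (a * a + b)
      ≡⟨ ℚP.*-identityˡ (- (a * a + b)) ⟩
    - (a * a + b) ∎
    where
    M f : ℚ
    M = (l ∸ 2) !⁻¹
    f = ℕ→ℚ ((l ∸ 2) !)
    collect : ∀ M f a b → M * (f * 1ℚ * ((- 1ℚ * a) * a + ((1ℚ * 1ℚ) * - b + 0ℚ * b))) ≡ M * f * - (a * a + b)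
    collect = solve-∀ ℚ-ring
  fDplus-value (suc (suc k)) = fDplus-2+k k

  rhs8p10-value : ∀ h i → rhs8p10 l h i ≡ H * (D * coefficient i)
  rhs8p10-value h 0 = begin
    rhs8p10 l h 0
      ≡⟨ rhs8p10-coeff l h 0 ⟩
    H * (ℕ→ℚ l * 0ℚ + - ℕ→ℚ 2 * (1ℚ * 1ℚ)) + H * (c₂ * 0ℚ + (- c₁ * 0ℚ + c₀ * (1ℚ * 1ℚ)))
      ≡⟨ coefficient-identity-0 y H (ℕ→ℚ l) c₂ c₁ ⟦2l⟧ ⟦2[l∸1]⟧ ⟩
    H * (D * 1ℚ) ∎
  rhs8p10-value h 1 = begin
    rhs8p10 l h 1
      ≡⟨ rhs8p10-coeff l h 1 ⟩
    H * (ℕ→ℚ l * (1ℚ * 1ℚ) + - ℕ→ℚ 2 * fB l 1) + H * (c₂ * 0ℚ + (- c₁ * (1ℚ * 1ℚ) + c₀ * fB (l ∸ 1) 1))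
      ≡⟨ cong₂ (λ u v → H * (ℕ→ℚ l * (1ℚ * 1ℚ) + - ℕ→ℚ 2 * u) + H * (c₂ * 0ℚ + (- c₁ * (1ℚ * 1ℚ) + c₀ * v)))
               (fB-1 l) (fB-1 (l ∸ 1)) ⟩
    H * (ℕ→ℚ l * (1ℚ * 1ℚ) + - ℕ→ℚ 2 * (- 1ℚ * (ℕ→ℚ l * (ℕ→ℚ l + 1ℚ))))
      + H * (c₂ * 0ℚ + (- c₁ * (1ℚ * 1ℚ) + c₀ * (- 1ℚ * (ℕ→ℚ (l ∸ 1) * (ℕ→ℚ (l ∸ 1) + 1ℚ)))))
      ≡⟨ coefficient-identity-1 y H c₂ ⟦l∸2⟧ ⟦3l∸4⟧ ⟦l⟧ ⟦5l⟧ ⟦2l⟧ ⟦2[l∸1]⟧ ⟦l∸1⟧ ⟩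
    H * (D * - (a * a + b)) ∎
  rhs8p10-value h (suc (suc k)) = rhs8p10-2+k k h

lemma8p10 : (l : ℕ) → (h : 5 ≤ l) → (i : ℕ) → fDplus l i ≡ rhs8p10 l h i
lemma8p10 _ h@(s≤s (s≤s (s≤s (s≤s (s≤s (z≤n {n})))))) i = begin
  fDplus l i              ≡⟨ fDplus-value i ⟩
  coefficient i           ≡⟨ sym (1/n*[n*x]≡x (2 ℕ.* (l ∸ 1)) (coefficient i)) ⟩
  H * (D * coefficient i) ≡⟨ sym (rhs8p10-value h i) ⟩
  rhs8p10 l h i           ∎
  where open Coefficients n
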